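{- Let $k\ge 2$ be an integer and let $G$ and $H$ be finite groups (written additively, not necessarily abelian) of orders $u$ and $v$ respectively. Suppose there exist a $(u,k,k-1)$-DDF in $G$, a $(v,k,k-1)$-DDF in $H$, and a $(v,k+1,1)$ difference matrix in $H$. Then there exists a $(uv,k,k-1)$-DDF in $G\times H$.
   Context: For a finite group $G$ written additively, a collection $\mathcal F$ of $k$-subsets (blocks) of $G$ is a $(|G|,k,\lambda)$ difference family (DF) in $G$ if the multiset $\Delta\mathcal F=\{x-y \mid (x,y)\in B\times B,\ x\neq y,\ B\in\mathcal F\}$ contains every non-zero element of $G$ exactly $\lambda$ times. It is a disjoint difference family (DDF) if its blocks are pairwise disjoint; a $(|G|,k,\lambda)$-DDF is a DDF that is a $(|G|,k,\lambda)$-DF. A $(v,k,1)$ difference matrix (DM) in a group $H$ of order $v$ is a $k\times v$ matrix with entries in $H$ such that for any two distinct rows, the entrywise differences of the two rows form a permutation of $H$ (i.e. contain every element of $H$ exactly once). -}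

module Defs where

open import Level using (0ℓ)
open import Data.Nat using (ℕ; suc)
open import Data.Fin using (Fin)
open import Data.Fin.Properties using (*↔×) renaming (_≟_ to _≟ᶠ_)
open import Data.Product using (Σ; _×_; _,_; proj₁; proj₂)
open import Data.List using (List; []; _∷_; length; filter; map; concatMap; allFin)
open import Data.List.Relation.Unary.All using (All)
open import Data.List.Relation.Unary.AllPairs using (AllPairs)
open import Data.List.Relation.Unary.Unique.Propositional using (Unique)
open import Data.List.Relation.Binary.Disjoint.Propositional using (Disjoint)
open import Relation.Nullary using (¬_; Dec; yes; no; ¬?)

open import Relation.Binary.PropositionalEquality
  using (_≡_; refl; sym; trans; cong; cong₂; isEquivalence)
open import Relation.Binary.Definitions using (DecidableEquality)
open import Algebra.Structures using (IsGroup; IsMonoid; IsSemigroup; IsMagma)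
open import Function.Bundles using (_↔_; Inverse; mk↔ₛ′)

record FiniteGroup (u : ℕ) : Set₁ where
  infixl 6 _+_ _-_
  field
    Carrier : Set
    _+_     : Carrier → Carrier → Carrier
    0#      : Carrier
    -_      : Carrier → Carrier
    isGroup : IsGroup _≡_ _+_ 0# -_
    enum    : Carrier ↔ Fin u

  _-_ : Carrier → Carrier → Carrier
  x - y = x + (- y)

  _≟_ : DecidableEquality Carrier
  x ≟ y with Inverse.to enum x ≟ᶠ Inverse.to enum y
  ... | yes p = yes (trans (sym (Inverse.strictlyInverseʳ enum x))
                    (trans (cong (Inverse.from enum) p) (Inverse.strictlyInverseʳ enum y)))
  ... | no ¬p = no (λ e → ¬p (cong (Inverse.to enum) e))

module _ {u : ℕ} (G : FiniteGroup u) where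
  open FiniteGroup G

  count : Carrier → List Carrier → ℕ
  count g xs = length (filter (g ≟_) xs)

  -- the multiset ΔF = { x - y | (x,y) ∈ B × B, x ≠ y, B ∈ F }
  -- (blocks are duplicate-free, so x ≠ y as elements = distinct positions)
  Δ : List (List Carrier) → List Carrier
  Δ F = concatMap (λ B → concatMap (λ x → map (λ y → x - y) (filter (λ y → ¬? (x ≟ y)) B)) B) F

  IsKSubset : ℕ → List Carrier → Set
  IsKSubset k B = Unique B × length B ≡ k

  IsDF : ℕ → ℕ → List (List Carrier) → Set
  IsDF k λ' F = All (IsKSubset k) F × (∀ g → ¬ (g ≡ 0#) → count g (Δ F) ≡ λ')

  IsDDF : ℕ → ℕ → List (List Carrier) → Set
  IsDDF k λ' F = IsDF k λ' F × AllPairs Disjoint F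

  HasDDF : ℕ → ℕ → Set
  HasDDF k λ' = Σ (List (List Carrier)) (IsDDF k λ')

  IsDM : (k : ℕ) → (Fin k → Fin u → Carrier) → Set
  IsDM k M = ∀ (i j : Fin k) → ¬ (i ≡ j) → ∀ g →
             count g (map (λ c → M i c - M j c) (allFin u)) ≡ 1

  HasDM : ℕ → Set
  HasDM k = Σ (Fin k → Fin u → Carrier) (IsDM k)

_×ᴳ_ : ∀ {u v} → FiniteGroup u → FiniteGroup v → FiniteGroup (u Data.Nat.* v)
_×ᴳ_ {u} {v} G H = record
  { Carrier = G.Carrier × H.Carrier
  ; _+_ = _⊕_
  ; 0# = (G.0# , H.0#)
  ; -_ = neg
  ; isGroup = isG
  ; enum = en
  }
  where
  module G = FiniteGroup G
  module H = FiniteGroup H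
  module GG = IsGroup G.isGroup
  module HG = IsGroup H.isGroup
  _⊕_ : G.Carrier × H.Carrier → G.Carrier × H.Carrier → G.Carrier × H.Carrier
  (a , b) ⊕ (c , d) = (a G.+ c , b H.+ d)
  neg : G.Carrier × H.Carrier → G.Carrier × H.Carrier
  neg (a , b) = (G.- a , H.- b)
  isG : IsGroup _≡_ _⊕_ (G.0# , H.0#) neg
  isG = record
    { isMonoid = record
      { isSemigroup = record
        { isMagma = record
          { isEquivalence = isEquivalence
          ; ∙-cong = λ { refl refl → refl } }
        ; assoc = λ { (a , b) (c , d) (e , f) → cong₂ _,_ (GG.assoc a c e) (HG.assoc b d f) } }
      ; identity = (λ { (a , b) → cong₂ _,_ (proj₁ GG.identity a) (proj₁ HG.identity b) })
                 , (λ { (a , b) → cong₂ _,_ (proj₂ GG.identity a) (proj₂ HG.identity b) }) }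
    ; inverse = (λ { (a , b) → cong₂ _,_ (proj₁ GG.inverse a) (proj₁ HG.inverse b) })
              , (λ { (a , b) → cong₂ _,_ (proj₂ GG.inverse a) (proj₂ HG.inverse b) })
    ; ⁻¹-cong = λ { refl → refl } }
  en : (G.Carrier × H.Carrier) ↔ Fin (u Data.Nat.* v)
  en = mk↔ₛ′
    (λ { (a , b) → Inverse.from (*↔× {u} {v}) (Inverse.to G.enum a , Inverse.to H.enum b) })
    (λ n → let (i , j) = Inverse.to (*↔× {u} {v}) n in (Inverse.from G.enum i , Inverse.from H.enum j))
    (λ n → trans (cong (Inverse.from (*↔× {u} {v}))
                   (cong₂ _,_ (Inverse.strictlyInverseˡ G.enum _) (Inverse.strictlyInverseˡ H.enum _)))
                 (Inverse.strictlyInverseʳ (*↔× {u} {v}) n))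
    (λ { (a , b) → trans (cong (λ p → (Inverse.from G.enum (proj₁ p) , Inverse.from H.enum (proj₂ p)))
                                 (Inverse.strictlyInverseˡ (*↔× {u} {v}) _))
                         (cong₂ _,_ (Inverse.strictlyInverseʳ G.enum a) (Inverse.strictlyInverseʳ H.enum b)) })

-- If FG has
-- n blocks, counting differences gives u = nk + 1, so some g₀ ∈ G lies in no block of FG.
-- Subtract the last row of M from the others and take the blocks {(a_t , M_t c − M_k c)} for every
-- block A = {a_0, …, a_(k−1)} of FG and column c, together with {g₀} × B for every block B of FH.
-- A difference (g , h) with g ≠ 0 comes only from blocks of the first kind, from pairs with
-- a_t − a_s = g, and then from exactly one column c, because rows t ≠ s of M differ by a
-- permutation of H; so it occurs k − 1 times, as g does in FG. A difference (0 , h) comes only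
-- from the blocks {g₀} × B, hence k − 1 times, as h does in FH. The normalisation makes the blocks
-- from one A disjoint, and g₀ keeps {g₀} × B away from all the others.

module Submission where

open import Level using (0ℓ)
open import Algebra.Bundles using (Group)
open import Algebra.Structures using (IsGroup)
import Algebra.Properties.Group as GroupProperties
open import Data.Empty using (⊥-elim)
open import Data.Fin using (Fin; zero; suc; toℕ; fromℕ)
import Data.Fin.Properties as Fin
open import Data.List
  using (List; []; _∷_; length; map; concat; concatMap; filter; _++_; tabulate; allFin; lookup)
import Data.List.Properties as List
open import Data.List.Membership.Propositional using (_∈_; _∉_)
open import Data.List.Membership.Propositional.Properties
  using (∈-tabulate⁺; ∈-tabulate⁻; ∈-map⁻; ∈-length; ∈-concat⁺′; ∈-lookup; ∈-allFin)
open import Data.List.Relation.Unary.All as All using (All; []; _∷_)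
open import Data.List.Relation.Unary.Any as Any using (here; there; any?)
open import Data.List.Relation.Unary.AllPairs as AllPairs using (AllPairs; []; _∷_)
import Data.List.Relation.Unary.AllPairs.Properties as AllPairs⁺
import Data.List.Relation.Unary.All.Properties as All⁺
open import Data.List.Relation.Unary.Unique.Propositional using (Unique)
open import Data.List.Relation.Binary.Disjoint.Propositional using (Disjoint)
import Data.List.Relation.Unary.Unique.Propositional.Properties as Unique
open import Data.Nat using (ℕ; suc; _+_; _*_; _∸_; _≤_; _<_; z≤n; s≤s)
open import Data.Nat.DivMod using (_mod_; m<n⇒m%n≡m)
open import Data.Nat.Properties hiding (_≟_)
open import Data.Product using (∃-syntax; _×_; _,_; proj₁; proj₂)
open import Function using (_∘_)
open import Function.Bundles using (Inverse)
open import Relation.Binary.PropositionalEquality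
open import Relation.Nullary using (yes; no; ¬?)
open import Defs
open import Algebra.Properties.CommutativeSemigroup +-commutativeSemigroup
  using () renaming (interchange to +-interchange; xy∙z≈zy∙x to [x+y]+z≡[z+y]+x)

private variable
  A B : Set

-- Finite sums over lists

∑ : List A → (A → ℕ) → ℕ
∑ []       f = 0
∑ (x ∷ xs) f = f x + ∑ xs f

syntax ∑ xs (λ x → e) = ∑[ x ∈ xs ] e

∑-congᴬ : {f g : A → ℕ} {xs : List A} → All (λ x → f x ≡ g x) xs → ∑ xs f ≡ ∑ xs g
∑-congᴬ []         = refl
∑-congᴬ (eq ∷ eqs) = cong₂ _+_ eq (∑-congᴬ eqs)

∑-cong : {f g : A → ℕ} (xs : List A) → (∀ x → f x ≡ g x) → ∑ xs f ≡ ∑ xs g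
∑-cong xs eq = ∑-congᴬ (All.universal eq xs)

∑-zeroᴬ : {f : A → ℕ} {xs : List A} → All (λ x → f x ≡ 0) xs → ∑ xs f ≡ 0
∑-zeroᴬ []         = refl
∑-zeroᴬ (eq ∷ eqs) = cong₂ _+_ eq (∑-zeroᴬ eqs)

∑-zero : {f : A → ℕ} (xs : List A) → (∀ x → f x ≡ 0) → ∑ xs f ≡ 0
∑-zero xs eq = ∑-zeroᴬ (All.universal eq xs)

∑-const : (xs : List A) (c : ℕ) → ∑[ x ∈ xs ] c ≡ length xs * c
∑-const []       c = refl
∑-const (x ∷ xs) c = cong (c +_) (∑-const xs c)

∑-+ : (xs : List A) (f g : A → ℕ) → ∑[ x ∈ xs ] (f x + g x) ≡ ∑ xs f + ∑ xs g
∑-+ []       f g = refl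
∑-+ (x ∷ xs) f g = trans (cong (f x + g x +_) (∑-+ xs f g)) (+-interchange (f x) (g x) _ _)

∑-*ˡ : (xs : List A) (c : ℕ) (f : A → ℕ) → ∑[ x ∈ xs ] (c * f x) ≡ c * ∑ xs f
∑-*ˡ []       c f = sym (*-zeroʳ c)
∑-*ˡ (x ∷ xs) c f = trans (cong (c * f x +_) (∑-*ˡ xs c f)) (sym (*-distribˡ-+ c (f x) _))

∑-swap : (xs : List A) (ys : List B) (f : A → B → ℕ) →
         ∑[ x ∈ xs ] ∑[ y ∈ ys ] f x y ≡ ∑[ y ∈ ys ] ∑[ x ∈ xs ] f x y
∑-swap []       ys f = sym (∑-zero ys (λ _ → refl))
∑-swap (x ∷ xs) ys f =
  trans (cong (∑ ys (f x) +_) (∑-swap xs ys f)) (sym (∑-+ ys (f x) (λ y → ∑[ x ∈ xs ] f x y)))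

∑-++ : (xs ys : List A) (f : A → ℕ) → ∑ (xs ++ ys) f ≡ ∑ xs f + ∑ ys f
∑-++ []       ys f = refl
∑-++ (x ∷ xs) ys f = trans (cong (f x +_) (∑-++ xs ys f)) (sym (+-assoc (f x) _ _))

∑-map : (g : B → A) (xs : List B) (f : A → ℕ) → ∑ (map g xs) f ≡ ∑[ x ∈ xs ] f (g x)
∑-map g []       f = refl
∑-map g (x ∷ xs) f = cong (f (g x) +_) (∑-map g xs f)

∑-concat : (xss : List (List A)) (f : A → ℕ) → ∑ (concat xss) f ≡ ∑[ xs ∈ xss ] ∑ xs f
∑-concat []         f = refl
∑-concat (xs ∷ xss) f = trans (∑-++ xs _ f) (cong (∑ xs f +_) (∑-concat xss f))

∑-concatMap : (g : B → List A) (xs : List B) (f : A → ℕ) →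
              ∑ (concatMap g xs) f ≡ ∑[ x ∈ xs ] ∑ (g x) f
∑-concatMap g xs f = trans (∑-concat (map g xs) f) (∑-map g xs (λ ys → ∑ ys f))

∑-tabulate : ∀ {n} (g : Fin n → A) (f : A → ℕ) → ∑ (tabulate g) f ≡ ∑[ i ∈ allFin n ] f (g i)
∑-tabulate g f =
  trans (cong (λ xs → ∑ xs f) (sym (List.map-tabulate (λ i → i) g))) (∑-map g (allFin _) f)

∑-lookup : (xs : List A) (f : A → ℕ) → ∑ xs f ≡ ∑[ i ∈ allFin (length xs) ] f (lookup xs i)
∑-lookup xs f =
  trans (cong (λ ys → ∑ ys f) (sym (List.tabulate-lookup xs))) (∑-tabulate (lookup xs) f)

length≡∑1 : (xs : List A) → length xs ≡ ∑[ x ∈ xs ] 1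
length≡∑1 xs = trans (sym (*-identityʳ (length xs))) (sym (∑-const xs 1))

∑-mono-≤ : {f g : A → ℕ} (xs : List A) → (∀ x → f x ≤ g x) → ∑ xs f ≤ ∑ xs g
∑-mono-≤ []       le = z≤n
∑-mono-≤ (x ∷ xs) le = +-mono-≤ (le x) (∑-mono-≤ xs le)

∑-≥-∈ : {f : A → ℕ} {x : A} {xs : List A} → x ∈ xs → f x ≤ ∑ xs f
∑-≥-∈ (here refl) = m≤m+n _ _
∑-≥-∈ {f = f} {xs = y ∷ _} (there x∈) = ≤-trans (∑-≥-∈ x∈) (m≤n+m _ (f y))

∑-≥-pair : {f : A → ℕ} {x y : A} {xs : List A} → x ≢ y → x ∈ xs → y ∈ xs → f x + f y ≤ ∑ xs f
∑-≥-pair x≢y (here refl)  (here refl)  = ⊥-elim (x≢y refl)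
∑-≥-pair x≢y (here refl)  (there y∈)   = +-monoʳ-≤ _ (∑-≥-∈ y∈)
∑-≥-pair {f = f} {x} {y} x≢y (there x∈) (here refl) =
  ≤-trans (≤-reflexive (+-comm (f x) (f y))) (+-monoʳ-≤ (f y) (∑-≥-∈ x∈))
∑-≥-pair {f = f} {xs = z ∷ _} x≢y (there x∈) (there y∈) =
  ≤-trans (∑-≥-pair x≢y x∈ y∈) (m≤n+m _ (f z))

∑-update : {f g : A → ℕ} {j : A} {xs : List A} → Unique xs → j ∈ xs →
           (∀ x → x ≢ j → f x ≡ g x) → ∑ xs f + g j ≡ ∑ xs g + f j
∑-update {f = f} {g} (x∉xs ∷ _) (here refl) agree =
  trans (cong (λ s → f _ + s + g _) (∑-congᴬ (All.map (λ j≢y → agree _ (≢-sym j≢y)) x∉xs)))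
        ([x+y]+z≡[z+y]+x (f _) _ (g _))
∑-update {f = f} {g} {j} {x ∷ xs} (x∉xs ∷ u) (there j∈) agree = begin
  f x + ∑ xs f + g j   ≡⟨ +-assoc (f x) _ _ ⟩
  f x + (∑ xs f + g j) ≡⟨ cong₂ _+_ (agree x (All.lookup x∉xs j∈)) (∑-update u j∈ agree) ⟩
  g x + (∑ xs g + f j) ≡⟨ +-assoc (g x) _ _ ⟨
  g x + ∑ xs g + f j   ∎
  where open ≡-Reasoning

∑-point : {f : A → ℕ} {j : A} {xs : List A} → Unique xs → j ∈ xs →
          (∀ x → x ≢ j → f x ≡ 0) → ∑ xs f ≡ f j
∑-point {xs = xs} u j∈ vanish =
  trans (sym (+-identityʳ _)) (trans (∑-update u j∈ vanish) (cong (_+ _) (∑-zero xs (λ _ → refl))))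

lookup-injective : {xs : List A} → Unique xs →
                   {i j : Fin (length xs)} → lookup xs i ≡ lookup xs j → i ≡ j
lookup-injective {xs = _ ∷ _} _          {zero}  {zero}  _  = refl
lookup-injective {xs = _ ∷ _} (x∉xs ∷ _) {zero}  {suc j} eq =
  ⊥-elim (All.lookup x∉xs (∈-lookup j) eq)
lookup-injective {xs = _ ∷ _} (x∉xs ∷ _) {suc i} {zero}  eq =
  ⊥-elim (All.lookup x∉xs (∈-lookup i) (sym eq))
lookup-injective {xs = _ ∷ _} (_ ∷ u)    {suc i} {suc j} eq = cong suc (lookup-injective u eq)

length-concat : (xss : List (List A)) → length (concat xss) ≡ ∑[ xs ∈ xss ] length xs
length-concat xss =
  trans (length≡∑1 (concat xss)) (trans (∑-concat xss _) (∑-cong xss (λ xs → sym (length≡∑1 xs))))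

length-concatMap : (g : A → List B) (xs : List A) →
                   length (concatMap g xs) ≡ ∑[ x ∈ xs ] length (g x)
length-concatMap g xs = trans (length-concat (map g xs)) (∑-map g xs length)

module _ {P : B → Set} {n : ℕ} {f : A → Fin n → B} where

  All-grid : {xs : List A} → All (λ a → ∀ c → P (f a c)) xs →
             All P (concatMap (λ a → map (f a) (allFin n)) xs)
  All-grid ps = All⁺.concat⁺ (All⁺.map⁺ (All.map (λ p → All⁺.map⁺ (All.universal p (allFin n))) ps))

module _ {R : B → B → Set} {n : ℕ} {f : A → Fin n → B} where

  AllPairs-grid : {xs : List A} →
    All (λ a → ∀ {c c′} → c ≢ c′ → R (f a c) (f a c′)) xs →
    AllPairs (λ a a′ → ∀ c c′ → R (f a c) (f a′ c′)) xs →
    AllPairs R (concatMap (λ a → map (f a) (allFin n)) xs)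
  AllPairs-grid within across = AllPairs⁺.concat⁺
    (All⁺.map⁺ (All.map (λ w → AllPairs⁺.map⁺ (AllPairs.map (λ c≢c′ → w c≢c′) (Unique.allFin⁺ n)))
                        within))
    (AllPairs⁺.map⁺ (AllPairs.map (λ r → All⁺.map⁺ (All.universal
      (λ c → All⁺.map⁺ (All.universal (r c) (allFin n))) (allFin n))) across))

-- Counting differences in a finite group

module _ {u : ℕ} (G : FiniteGroup u) where
  open FiniteGroup G renaming (_+_ to _⊕_)
  open IsGroup isGroup using (assoc; inverseʳ)

  private
    group : Group 0ℓ 0ℓ
    group = record { Carrier = Carrier; _≈_ = _≡_; _∙_ = _⊕_; ε = 0#; _⁻¹ = -_; isGroup = isGroup }

  open import Data.List.Membership.DecPropositional _≟_ using (_∈?_; _∉?_)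
  open GroupProperties group using (x∙y⁻¹≈ε⇒x≈y; \\-leftDividesʳ; //-rightDividesʳ)

  x-x≡0# : ∀ x → x - x ≡ 0#
  x-x≡0# = inverseʳ

  x-y≡0#⇒x≡y : ∀ {x y} → x - y ≡ 0# → x ≡ y
  x-y≡0#⇒x≡y = x∙y⁻¹≈ε⇒x≈y _ _

  [x-z]-[y-z]≡x-y : ∀ x y z → (x - z) - (y - z) ≡ x - y
  [x-z]-[y-z]≡x-y x y z = begin
    (x - z) - (y - z)             ≡⟨ cong (_- (y - z)) x-z≡[x-y]+[y-z] ⟩
    ((x - y) ⊕ (y - z)) - (y - z) ≡⟨ //-rightDividesʳ (y - z) (x - y) ⟩
    x - y                         ∎
    where
    open ≡-Reasoning
    x-z≡[x-y]+[y-z] : x - z ≡ (x - y) ⊕ (y - z)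
    x-z≡[x-y]+[y-z] = sym (trans (assoc x (- y) (y - z)) (cong (x ⊕_) (\\-leftDividesʳ y (- z))))

  δ : Carrier → Carrier → ℕ
  δ z x with z ≟ x
  ... | yes _ = 1
  ... | no  _ = 0

  δ-≡ : ∀ {z x} → z ≡ x → δ z x ≡ 1
  δ-≡ {z} {x} z≡x with z ≟ x
  ... | yes _   = refl
  ... | no  z≢x = ⊥-elim (z≢x z≡x)

  δ-≢ : ∀ {z x} → z ≢ x → δ z x ≡ 0
  δ-≢ {z} {x} z≢x with z ≟ x
  ... | yes z≡x = ⊥-elim (z≢x z≡x)
  ... | no  _   = refl

  δ*≡δ : ∀ {z x} n → (z ≡ x → n ≡ 1) → δ z x * n ≡ δ z x
  δ*≡δ {z} {x} n one with z ≟ x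
  ... | yes z≡x = trans (+-identityʳ n) (one z≡x)
  ... | no  _   = refl

  δ*≡0 : ∀ {z x} n → (z ≡ x → n ≡ 0) → δ z x * n ≡ 0
  δ*≡0 {z} {x} n vanish with z ≟ x
  ... | yes z≡x = trans (+-identityʳ n) (vanish z≡x)
  ... | no  _   = refl

  count≡∑δ : ∀ z xs → count G z xs ≡ ∑ xs (δ z)
  count≡∑δ z []       = refl
  count≡∑δ z (x ∷ xs) with z ≟ x
  ... | yes _ = cong suc (count≡∑δ z xs)
  ... | no  _ = count≡∑δ z xs

  count-map : ∀ z (f : A → Carrier) xs → count G z (map f xs) ≡ ∑[ x ∈ xs ] δ z (f x)
  count-map z f xs = trans (count≡∑δ z (map f xs)) (∑-map f xs (δ z))

  count-concatMap : ∀ z (f : A → List Carrier) xs →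
                    count G z (concatMap f xs) ≡ ∑[ x ∈ xs ] count G z (f x)
  count-concatMap z f xs = trans (count≡∑δ z (concatMap f xs))
    (trans (∑-concatMap f xs (δ z)) (∑-cong xs (λ x → sym (count≡∑δ z (f x)))))

  ∈⇒0<count : ∀ {x xs} → x ∈ xs → 0 < count G x xs
  ∈⇒0<count {x} {xs} x∈xs = begin
    1             ≡⟨ δ-≡ refl ⟨
    δ x x         ≤⟨ ∑-≥-∈ x∈xs ⟩
    ∑ xs (δ x)    ≡⟨ count≡∑δ x xs ⟨
    count G x xs  ∎
    where open ≤-Reasoning

  without : Carrier → List Carrier → List Carrier
  without x B = filter (λ y → ¬? (x ≟ y)) B

  differences : List Carrier → List Carrier
  differences B = concatMap (λ x → map (λ y → x - y) (without x B)) B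

  -- The diagonal pairs x = y are counted too, so this is the multiplicity of z among the
  -- differences of B only when z ≢ 0#.
  differenceCount : Carrier → List Carrier → ℕ
  differenceCount z B = ∑[ x ∈ B ] ∑[ y ∈ B ] δ z (x - y)

  differenceCount-tabulate : ∀ {n} z (f : Fin n → Carrier) →
    differenceCount z (tabulate f) ≡ ∑[ i ∈ allFin n ] ∑[ j ∈ allFin n ] δ z (f i - f j)
  differenceCount-tabulate {n} z f =
    trans (∑-tabulate f _) (∑-cong (allFin n) (λ i → ∑-tabulate f (λ y → δ z (f i - y))))

  differenceCount-lookup : ∀ z A →
    differenceCount z A ≡
      ∑[ i ∈ allFin (length A) ] ∑[ j ∈ allFin (length A) ] δ z (lookup A i - lookup A j)
  differenceCount-lookup z A =
    trans (cong (differenceCount z) (sym (List.tabulate-lookup A)))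
          (differenceCount-tabulate z (lookup A))

  ∑-without : ∀ {x} (f : Carrier → ℕ) → f x ≡ 0 → ∀ B → ∑ (without x B) f ≡ ∑ B f
  ∑-without         f fx≡0 []      = refl
  ∑-without {x = x} f fx≡0 (b ∷ B) with x ≟ b
  ... | yes refl = trans (∑-without f fx≡0 B) (cong (_+ ∑ B f) (sym fx≡0))
  ... | no  _    = cong (f b +_) (∑-without f fx≡0 B)

  length-without : ∀ {x B} → Unique B → x ∈ B → length (without x B) ≡ length B ∸ 1
  length-without {x} {b ∷ B} (b∉B ∷ _) (here refl) with x ≟ b
  ... | yes _   = cong length (List.filter-all (λ y → ¬? (x ≟ y)) b∉B)
  ... | no  x≢x = ⊥-elim (x≢x refl)
  length-without {x} {b ∷ B} (b∉B ∷ u) (there x∈B) with x ≟ b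
  ... | yes refl = ⊥-elim (All.lookup b∉B x∈B refl)
  ... | no  _    = trans (cong suc (length-without u x∈B)) (m+[n∸m]≡n (∈-length x∈B))

  count-differences : ∀ {z} → z ≢ 0# → ∀ B → count G z (differences B) ≡ differenceCount z B
  count-differences z≢0# B = trans (count-concatMap _ _ B) (∑-cong B (λ x →
    trans (count-map _ (λ y → x - y) (without x B))
          (∑-without _ (δ-≢ (λ z≡x-x → z≢0# (trans z≡x-x (x-x≡0# x)))) B)))

  count-0#-differences : ∀ B → count G 0# (differences B) ≡ 0
  count-0#-differences B = trans (count-concatMap _ _ B) (∑-zero B (λ x →
    trans (count-map _ (λ y → x - y) (without x B))
          (∑-zeroᴬ (All.map (λ x≢y → δ-≢ (λ 0#≡x-y → x≢y (x-y≡0#⇒x≡y (sym 0#≡x-y))))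
                            (All⁺.all-filter (λ y → ¬? (x ≟ y)) B)))))

  length-differences : ∀ {k B} → IsKSubset G k B → length (differences B) ≡ k * (k ∸ 1)
  length-differences {B = B} (unique , refl) = begin
    length (differences B)
      ≡⟨ length-concatMap _ B ⟩
    ∑[ x ∈ B ] length (map (λ y → x - y) (without x B))
      ≡⟨ ∑-congᴬ (All.tabulate length-map-without) ⟩
    ∑[ x ∈ B ] (length B ∸ 1)
      ≡⟨ ∑-const B _ ⟩
    length B * (length B ∸ 1)
      ∎
    where
    open ≡-Reasoning
    length-map-without : ∀ {x} → x ∈ B → length (map (λ y → x - y) (without x B)) ≡ length B ∸ 1
    length-map-without {x} x∈B = trans (List.length-map _ (without x B)) (length-without unique x∈B)

  count-Δ : ∀ {z} → z ≢ 0# → ∀ F → count G z (Δ G F) ≡ ∑[ B ∈ F ] differenceCount z B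
  count-Δ z≢0# F = trans (count-concatMap _ differences F) (∑-cong F (count-differences z≢0#))

  count-0#-Δ : ∀ F → count G 0# (Δ G F) ≡ 0
  count-0#-Δ F = trans (count-concatMap _ differences F) (∑-zero F count-0#-differences)

  length-Δ : ∀ {k F} → All (IsKSubset G k) F → length (Δ G F) ≡ length F * (k * (k ∸ 1))
  length-Δ {F = F} kF = trans (length-concatMap differences F)
    (trans (∑-congᴬ (All.map length-differences kF)) (∑-const F _))

  elements : List Carrier
  elements = tabulate (Inverse.from enum)

  elements-unique : Unique elements
  elements-unique = Unique.tabulate⁺ λ {i} {j} from-i≡from-j →
    trans (sym (Inverse.strictlyInverseˡ enum i))
          (trans (cong (Inverse.to enum) from-i≡from-j) (Inverse.strictlyInverseˡ enum j))

  ∈-elements : ∀ x → x ∈ elements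
  ∈-elements x =
    subst (_∈ elements) (Inverse.strictlyInverseʳ enum x) (∈-tabulate⁺ (Inverse.to enum x))

  length-elements : length elements ≡ u
  length-elements = List.length-tabulate _

  ∑-elements-count : ∀ xs → ∑[ g ∈ elements ] count G g xs ≡ length xs
  ∑-elements-count xs = begin
    ∑[ g ∈ elements ] count G g xs          ≡⟨ ∑-cong elements (λ g → count≡∑δ g xs) ⟩
    ∑[ g ∈ elements ] ∑[ x ∈ xs ] δ g x    ≡⟨ ∑-swap elements xs δ ⟩
    ∑[ x ∈ xs ] ∑[ g ∈ elements ] δ g x    ≡⟨ ∑-cong xs ∑-elements-δ ⟩
    ∑[ x ∈ xs ] 1                           ≡⟨ length≡∑1 xs ⟨
    length xs                               ∎
    where
    open ≡-Reasoning
    ∑-elements-δ : ∀ x → ∑[ g ∈ elements ] δ g x ≡ 1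
    ∑-elements-δ x = trans (∑-point elements-unique (∈-elements x) (λ _ → δ-≢)) (δ-≡ refl)

  covering⇒u≤length : ∀ {xs} → (∀ x → x ∈ xs) → u ≤ length xs
  covering⇒u≤length {xs} covering = begin
    u                                ≡⟨ length-elements ⟨
    length elements                  ≡⟨ length≡∑1 elements ⟩
    ∑[ g ∈ elements ] 1              ≤⟨ ∑-mono-≤ elements (λ g → ∈⇒0<count (covering g)) ⟩
    ∑[ g ∈ elements ] count G g xs   ≡⟨ ∑-elements-count xs ⟩
    length xs                        ∎
    where open ≤-Reasoning

  IsDF⇒length-Δ+λ≡u*λ : ∀ {k λ' F} → IsDF G k λ' F → length (Δ G F) + λ' ≡ u * λ'
  IsDF⇒length-Δ+λ≡u*λ {λ' = λ'} {F} (_ , df) = begin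
    length (Δ G F) + λ'                       ≡⟨ cong (_+ λ') (∑-elements-count (Δ G F)) ⟨
    ∑[ g ∈ elements ] count G g (Δ G F) + λ'  ≡⟨ ∑-update elements-unique (∈-elements 0#) df ⟩
    ∑[ g ∈ elements ] λ' + count G 0# (Δ G F) ≡⟨ cong₂ _+_ (∑-const elements λ') (count-0#-Δ F) ⟩
    length elements * λ' + 0                  ≡⟨ +-identityʳ _ ⟩
    length elements * λ'                      ≡⟨ cong (_* λ') length-elements ⟩
    u * λ'                                    ∎
    where open ≡-Reasoning

  IsDF⇒u≡1+n*k : ∀ {k F} → 2 ≤ k → IsDF G k (k ∸ 1) F → u ≡ suc (length F * k)
  IsDF⇒u≡1+n*k {suc (suc m)} {F} (s≤s (s≤s z≤n)) df@(kF , _) =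
    *-cancelʳ-≡ u (suc (n * k)) (suc m) (begin
    u * suc m                  ≡⟨ IsDF⇒length-Δ+λ≡u*λ df ⟨
    length (Δ G F) + suc m     ≡⟨ cong (_+ suc m) (length-Δ kF) ⟩
    n * (k * suc m) + suc m    ≡⟨ +-comm _ (suc m) ⟩
    suc m + n * (k * suc m)    ≡⟨ cong (suc m +_) (*-assoc n k (suc m)) ⟨
    suc (n * k) * suc m        ∎)
    where
    open ≡-Reasoning
    n k : ℕ
    n = length F
    k = suc (suc m)

  IsDF⇒∃uncovered : ∀ {k F} → 2 ≤ k → IsDF G k (k ∸ 1) F → ∃[ g ] All (g ∉_) F
  IsDF⇒∃uncovered {k} {F} 2≤k df with any? (_∉? concat F) elements
  ... | yes some = let (g , g∉F) = Any.satisfied some in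
                   g , All.tabulate (λ B∈F g∈B → g∉F (∈-concat⁺′ g∈B B∈F))
  ... | no none = ⊥-elim (1+n≰n (begin
    suc (length F * k)  ≡⟨ IsDF⇒u≡1+n*k 2≤k df ⟨
    u                   ≤⟨ covering⇒u≤length covered ⟩
    length (concat F)   ≡⟨ length-concat F ⟩
    ∑[ B ∈ F ] length B ≡⟨ ∑-congᴬ (All.map proj₂ (proj₁ df)) ⟩
    ∑[ B ∈ F ] k        ≡⟨ ∑-const F k ⟩
    length F * k        ∎))
    where
    open ≤-Reasoning
    covered : ∀ g → g ∈ concat F
    covered g with g ∈? concat F
    ... | yes g∈F = g∈F
    ... | no  g∉F = ⊥-elim (none (Any.map (λ { refl → g∉F }) (∈-elements g)))

  module _ {n} {M : Fin n → Fin u → Carrier} (isDM : IsDM G n M) {r s : Fin n} (r≢s : r ≢ s) where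

    ∑-δ-rowDifference : ∀ z → ∑[ c ∈ allFin u ] δ z (M r c - M s c) ≡ 1
    ∑-δ-rowDifference z = trans (sym (count-map z _ (allFin u))) (isDM r s r≢s z)

    rowDifference-injective : ∀ {c c′} → M r c - M s c ≡ M r c′ - M s c′ → c ≡ c′
    rowDifference-injective {c} {c′} eq with c Fin.≟ c′
    ... | yes c≡c′ = c≡c′
    ... | no  c≢c′ = ⊥-elim (1+n≰n (begin
      2                             ≡⟨ cong₂ _+_ (δ-≡ refl) (δ-≡ eq) ⟨
      δ z (D c) + δ z (D c′)        ≤⟨ ∑-≥-pair c≢c′ (∈-allFin c) (∈-allFin c′) ⟩
      ∑[ c″ ∈ allFin u ] δ z (D c″) ≡⟨ ∑-δ-rowDifference z ⟩
      1                             ∎))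
      where
      open ≤-Reasoning
      D : Fin u → Carrier
      D d = M r d - M s d
      z : Carrier
      z = D c

-- The product construction

module ProductConstruction
  {k u v : ℕ} (G : FiniteGroup u) (H : FiniteGroup v)
  (M : Fin (suc k) → Fin v → FiniteGroup.Carrier H) (isDM : IsDM H (suc k) M)
  (g₀ : FiniteGroup.Carrier G) where

  P : FiniteGroup (u * v)
  P = G ×ᴳ H

  private
    module G = FiniteGroup G
    module H = FiniteGroup H
    module P = FiniteGroup P

  row : ∀ {n} → Fin n → Fin (suc k)
  row t = toℕ t mod suc k

  toℕ-row : ∀ {n} {t : Fin n} → toℕ t < k → toℕ (row t) ≡ toℕ t
  toℕ-row t<k = trans (Fin.toℕ-fromℕ< _) (m<n⇒m%n≡m (m<n⇒m<1+n t<k))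

  row-injective : ∀ {n} {t s : Fin n} → toℕ t < k → toℕ s < k → row t ≡ row s → t ≡ s
  row-injective t<k s<k eq =
    Fin.toℕ-injective (trans (sym (toℕ-row t<k)) (trans (cong toℕ eq) (toℕ-row s<k)))

  row≢last : ∀ {n} {t : Fin n} → toℕ t < k → row t ≢ fromℕ k
  row≢last t<k eq = <⇒≢ t<k (trans (sym (toℕ-row t<k)) (trans (cong toℕ eq) (Fin.toℕ-fromℕ k)))

  toℕ<k : ∀ {A : List G.Carrier} → length A ≡ k → (t : Fin (length A)) → toℕ t < k
  toℕ<k refl t = Fin.toℕ<n t

  -- Subtracting the last row keeps the differences within a block equal to the row differences
  -- of M, while c ↦ entry t c becomes injective.
  entry : ∀ {n} → Fin n → Fin v → H.Carrier
  entry t c = M (row t) c H.- M (fromℕ k) c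

  block : List G.Carrier → Fin v → List (G.Carrier × H.Carrier)
  block A c = tabulate (λ t → lookup A t , entry t c)

  lift : List H.Carrier → List (G.Carrier × H.Carrier)
  lift B = map (g₀ ,_) B

  family : List (List G.Carrier) → List (List H.Carrier) → List (List (G.Carrier × H.Carrier))
  family FG FH = concatMap (λ A → map (block A) (allFin v)) FG ++ map lift FH

  δ-× : ∀ {g h a b} → δ P (g , h) (a , b) ≡ δ G g a * δ H h b
  δ-× {g} {h} {a} {b} with g G.≟ a | h H.≟ b
  ... | yes g≡a | yes h≡b = δ-≡ P (cong₂ _,_ g≡a h≡b)
  ... | no  g≢a | _       = δ-≢ P (g≢a ∘ cong proj₁)
  ... | yes _   | no  h≢b = δ-≢ P (h≢b ∘ cong proj₂)

  differenceCount-block : ∀ {g h} A c →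
    differenceCount P (g , h) (block A c) ≡
      ∑[ t ∈ allFin (length A) ] ∑[ s ∈ allFin (length A) ]
        (δ G g (lookup A t G.- lookup A s) * δ H h (M (row t) c H.- M (row s) c))
  differenceCount-block {g} {h} A c =
    trans (differenceCount-tabulate P (g , h) (λ t → lookup A t , entry t c))
      (∑-cong ts (λ t → ∑-cong ts (λ s →
        trans δ-× (cong (λ d → δ G g (lookup A t G.- lookup A s) * δ H h d)
                        ([x-z]-[y-z]≡x-y H (M (row t) c) (M (row s) c) (M (fromℕ k) c))))))
    where
    ts : List (Fin (length A))
    ts = allFin (length A)

  ∑-differenceCount-block : ∀ {g} h → g ≢ G.0# → ∀ {A} → length A ≡ k →
    ∑[ c ∈ allFin v ] differenceCount P (g , h) (block A c) ≡ differenceCount G g A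
  ∑-differenceCount-block {g} h g≢0# {A} |A|≡k = begin
    ∑[ c ∈ allFin v ] differenceCount P (g , h) (block A c)
      ≡⟨ ∑-cong (allFin v) (differenceCount-block A) ⟩
    ∑[ c ∈ allFin v ] ∑[ t ∈ ts ] ∑[ s ∈ ts ] (X t s * Y t s c)
      ≡⟨ ∑-swap (allFin v) ts _ ⟩
    ∑[ t ∈ ts ] ∑[ c ∈ allFin v ] ∑[ s ∈ ts ] (X t s * Y t s c)
      ≡⟨ ∑-cong ts (λ t → ∑-swap (allFin v) ts _) ⟩
    ∑[ t ∈ ts ] ∑[ s ∈ ts ] ∑[ c ∈ allFin v ] (X t s * Y t s c)
      ≡⟨ ∑-cong ts (λ t → ∑-cong ts (λ s → ∑-*ˡ (allFin v) (X t s) (Y t s))) ⟩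
    ∑[ t ∈ ts ] ∑[ s ∈ ts ] (X t s * ∑[ c ∈ allFin v ] Y t s c)
      ≡⟨ ∑-cong ts (λ t → ∑-cong ts (λ s → δ*≡δ G _ (∑-Y≡1 t s))) ⟩
    ∑[ t ∈ ts ] ∑[ s ∈ ts ] X t s
      ≡⟨ differenceCount-lookup G g A ⟨
    differenceCount G g A
      ∎
    where
    open ≡-Reasoning
    ts : List (Fin (length A))
    ts = allFin (length A)
    X : Fin (length A) → Fin (length A) → ℕ
    X t s = δ G g (lookup A t G.- lookup A s)
    Y : Fin (length A) → Fin (length A) → Fin v → ℕ
    Y t s c = δ H h (M (row t) c H.- M (row s) c)
    ∑-Y≡1 : ∀ t s → g ≡ lookup A t G.- lookup A s → ∑[ c ∈ allFin v ] Y t s c ≡ 1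
    ∑-Y≡1 t s g≡at-as = ∑-δ-rowDifference H isDM row-t≢row-s h
      where
      row-t≢row-s : row t ≢ row s
      row-t≢row-s row-t≡row-s = g≢0# (begin
        g                               ≡⟨ g≡at-as ⟩
        lookup A t G.- lookup A s       ≡⟨ cong (λ s′ → lookup A t G.- lookup A s′) t≡s ⟨
        lookup A t G.- lookup A t       ≡⟨ x-x≡0# G _ ⟩
        G.0#                            ∎)
        where
        t≡s : t ≡ s
        t≡s = row-injective (toℕ<k {A} |A|≡k t) (toℕ<k {A} |A|≡k s) row-t≡row-s

  differenceCount-block-0# : ∀ {h} → h ≢ H.0# → ∀ {A} → Unique A → ∀ c →
    differenceCount P (G.0# , h) (block A c) ≡ 0
  differenceCount-block-0# {h} h≢0# {A} unique c = trans (differenceCount-block A c)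
    (∑-zero ts (λ t → ∑-zero ts (λ s → δ*≡0 G _ (λ 0#≡at-as →
      vanish (lookup-injective unique (x-y≡0#⇒x≡y G (sym 0#≡at-as)))))))
    where
    ts : List (Fin (length A))
    ts = allFin (length A)
    vanish : ∀ {t s : Fin (length A)} → t ≡ s → δ H h (M (row t) c H.- M (row s) c) ≡ 0
    vanish refl = δ-≢ H (λ h≡0# → h≢0# (trans h≡0# (x-x≡0# H _)))

  differenceCount-lift : ∀ g h B →
    differenceCount P (g , h) (lift B) ≡ δ G g G.0# * differenceCount H h B
  differenceCount-lift g h B = begin
    differenceCount P (g , h) (lift B)
      ≡⟨ ∑-map (g₀ ,_) B (λ p → ∑[ q ∈ lift B ] δ P (g , h) (p P.- q)) ⟩
    ∑[ b ∈ B ] ∑[ q ∈ lift B ] δ P (g , h) ((g₀ , b) P.- q)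
      ≡⟨ ∑-cong B (λ b → ∑-map (g₀ ,_) B (λ q → δ P (g , h) ((g₀ , b) P.- q))) ⟩
    ∑[ b ∈ B ] ∑[ b′ ∈ B ] δ P (g , h) (g₀ G.- g₀ , b H.- b′)
      ≡⟨ ∑-cong B (λ b → ∑-cong B (λ b′ → trans δ-× (cong (λ d → δ G g d * _) (x-x≡0# G g₀)))) ⟩
    ∑[ b ∈ B ] ∑[ b′ ∈ B ] (δ G g G.0# * δ H h (b H.- b′))
      ≡⟨ ∑-cong B (λ b → ∑-*ˡ B (δ G g G.0#) (λ b′ → δ H h (b H.- b′))) ⟩
    ∑[ b ∈ B ] (δ G g G.0# * ∑[ b′ ∈ B ] δ H h (b H.- b′))
      ≡⟨ ∑-*ˡ B (δ G g G.0#) (λ b → ∑[ b′ ∈ B ] δ H h (b H.- b′)) ⟩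
    δ G g G.0# * differenceCount H h B
      ∎
    where open ≡-Reasoning

  count-Δ-family : ∀ {z} → z ≢ P.0# → ∀ FG FH →
    count P z (Δ P (family FG FH)) ≡
      ∑[ A ∈ FG ] ∑[ c ∈ allFin v ] differenceCount P z (block A c)
        + ∑[ B ∈ FH ] differenceCount P z (lift B)
  count-Δ-family {z} z≢0# FG FH = begin
    count P z (Δ P (family FG FH))
      ≡⟨ count-Δ P z≢0# (family FG FH) ⟩
    ∑ (blocks ++ lifts) (differenceCount P z)
      ≡⟨ ∑-++ blocks lifts (differenceCount P z) ⟩
    ∑ blocks (differenceCount P z) + ∑ lifts (differenceCount P z)
      ≡⟨ cong₂ _+_ (trans (∑-concatMap _ FG _) (∑-cong FG (λ A → ∑-map (block A) (allFin v) _)))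
                   (∑-map lift FH _) ⟩
    ∑[ A ∈ FG ] ∑[ c ∈ allFin v ] differenceCount P z (block A c)
      + ∑[ B ∈ FH ] differenceCount P z (lift B)
      ∎
    where
    open ≡-Reasoning
    blocks lifts : List (List P.Carrier)
    blocks = concatMap (λ A → map (block A) (allFin v)) FG
    lifts  = map lift FH

  count-Δ-family≡k∸1 : ∀ {FG FH} → IsDF G k (k ∸ 1) FG → IsDF H k (k ∸ 1) FH →
    ∀ z → z ≢ P.0# → count P z (Δ P (family FG FH)) ≡ k ∸ 1
  count-Δ-family≡k∸1 {FG} {FH} (kG , dfG) (kH , dfH) (g , h) z≢0# with g G.≟ G.0#
  ... | yes refl = begin
    count P (G.0# , h) (Δ P (family FG FH))
      ≡⟨ count-Δ-family z≢0# FG FH ⟩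
    ∑[ A ∈ FG ] ∑[ c ∈ allFin v ] differenceCount P (G.0# , h) (block A c)
      + ∑[ B ∈ FH ] differenceCount P (G.0# , h) (lift B)
      ≡⟨ cong₂ _+_ (∑-zeroᴬ (All.map (λ (unique , _) →
                                 ∑-zero (allFin v) (differenceCount-block-0# h≢0# unique)) kG))
                   (∑-cong FH (λ B → trans (differenceCount-lift G.0# h B)
                                           (trans (cong (_* _) (δ-≡ G refl)) (*-identityˡ _)))) ⟩
    0 + ∑[ B ∈ FH ] differenceCount H h B
      ≡⟨ count-Δ H h≢0# FH ⟨
    count H h (Δ H FH)
      ≡⟨ dfH h h≢0# ⟩
    k ∸ 1
      ∎
    where
    open ≡-Reasoning
    h≢0# : h ≢ H.0#
    h≢0# h≡0# = z≢0# (cong (G.0# ,_) h≡0#)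
  ... | no g≢0# = begin
    count P (g , h) (Δ P (family FG FH))
      ≡⟨ count-Δ-family z≢0# FG FH ⟩
    ∑[ A ∈ FG ] ∑[ c ∈ allFin v ] differenceCount P (g , h) (block A c)
      + ∑[ B ∈ FH ] differenceCount P (g , h) (lift B)
      ≡⟨ cong₂ _+_ (∑-congᴬ (All.map (λ {A} (_ , |A|≡k) →
                                  ∑-differenceCount-block h g≢0# {A} |A|≡k) kG))
                   (∑-zero FH (λ B → trans (differenceCount-lift g h B)
                                          (cong (_* _) (δ-≢ G g≢0#)))) ⟩
    ∑[ A ∈ FG ] differenceCount G g A + 0
      ≡⟨ +-identityʳ _ ⟩
    ∑[ A ∈ FG ] differenceCount G g A
      ≡⟨ count-Δ G g≢0# FG ⟨
    count G g (Δ G FG)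
      ≡⟨ dfG g g≢0# ⟩
    k ∸ 1
      ∎
    where open ≡-Reasoning

  block-isKSubset : ∀ {A} → IsKSubset G k A → ∀ c → IsKSubset P k (block A c)
  block-isKSubset (unique , |A|≡k) c =
    Unique.tabulate⁺ (lookup-injective unique ∘ cong proj₁) , trans (List.length-tabulate _) |A|≡k

  lift-isKSubset : ∀ {B} → IsKSubset H k B → IsKSubset P k (lift B)
  lift-isKSubset {B} (unique , |B|≡k) =
    Unique.map⁺ (cong proj₂) unique , trans (List.length-map _ B) |B|≡k

  block-disjoint : ∀ {A A′} → Disjoint A A′ → ∀ c c′ → Disjoint (block A c) (block A′ c′)
  block-disjoint A∩A′≡∅ c c′ (p∈ , p∈′) with ∈-tabulate⁻ p∈ | ∈-tabulate⁻ p∈′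
  ... | t , refl | t′ , eq = A∩A′≡∅ (∈-lookup t , subst (_∈ _) (sym (cong proj₁ eq)) (∈-lookup t′))

  block-disjoint-column : ∀ {A} → IsKSubset G k A →
                          ∀ {c c′} → c ≢ c′ → Disjoint (block A c) (block A c′)
  block-disjoint-column {A} (unique , |A|≡k) c≢c′ (p∈ , p∈′) with ∈-tabulate⁻ p∈ | ∈-tabulate⁻ p∈′
  ... | t , refl | t′ , eq with lookup-injective unique (cong proj₁ eq)
  ...   | refl =
    c≢c′ (rowDifference-injective H isDM (row≢last (toℕ<k {A} |A|≡k t)) (cong proj₂ eq))

  lift-disjoint : ∀ {B B′} → Disjoint B B′ → Disjoint (lift B) (lift B′)
  lift-disjoint B∩B′≡∅ (p∈ , p∈′) with ∈-map⁻ _ p∈ | ∈-map⁻ _ p∈′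
  ... | b , b∈B , refl | b′ , b′∈B′ , eq = B∩B′≡∅ (b∈B , subst (_∈ _) (sym (cong proj₂ eq)) b′∈B′)

  block-lift-disjoint : ∀ {A} → g₀ ∉ A → ∀ c B → Disjoint (block A c) (lift B)
  block-lift-disjoint g₀∉A c B (p∈ , p∈′) with ∈-tabulate⁻ p∈ | ∈-map⁻ _ p∈′
  ... | t , refl | b , _ , eq = g₀∉A (subst (_∈ _) (cong proj₁ eq) (∈-lookup t))

  family-isDDF : ∀ {FG FH} → IsDDF G k (k ∸ 1) FG → IsDDF H k (k ∸ 1) FH → All (g₀ ∉_) FG →
                 IsDDF P k (k ∸ 1) (family FG FH)
  family-isDDF {FG} {FH} (dfG@(kG , _) , disjointG) (dfH@(kH , _) , disjointH) g₀∉FG =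
    ( All⁺.++⁺ (All-grid (All.map block-isKSubset kG)) (All⁺.map⁺ (All.map lift-isKSubset kH))
    , count-Δ-family≡k∸1 dfG dfH )
    , AllPairs⁺.++⁺
        (AllPairs-grid (All.map block-disjoint-column kG) (AllPairs.map block-disjoint disjointG))
        (AllPairs⁺.map⁺ (AllPairs.map lift-disjoint disjointH))
        (All-grid (All.map (λ g₀∉A c → All⁺.map⁺ (All.universal (block-lift-disjoint g₀∉A c) FH))
                           g₀∉FG))

mainTheorem1 : (k u v : ℕ) → 2 ≤ k → (G : FiniteGroup u) → (H : FiniteGroup v)
    → HasDDF G k (k ∸ 1) → HasDDF H k (k ∸ 1) → HasDM H (suc k)
    → HasDDF (G ×ᴳ H) k (k ∸ 1)
mainTheorem1 k u v 2≤k G H (FG , ddfG) (FH , ddfH) (M , isDM)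
  with g₀ , g₀∉FG ← IsDF⇒∃uncovered G 2≤k (proj₁ ddfG) =
  let open ProductConstruction G H M isDM g₀ in
  family FG FH , family-isDDF ddfG ddfH g₀∉FG
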